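{- Let $P$ be a black-rooted colored tree poset with at least one white element but no blocking triple, and let $m$ be the integer game value of $\mathrm{Po}(P)$. Then in the game $\mathrm{Po}(P)-m$ with Black moving first, White has a winning strategy under which Black never gets an opportunity to remove the root of $P$ (i.e., during play following this strategy, it never happens that it is Black's turn while the root of $P$ is still present and maximal in the remaining poset of the $\mathrm{Po}(P)$ component).
   Context: A tree poset is either empty or a finite poset in which every element except one (the root) covers exactly one element; colored means each element is colored black or white, and black-rooted means the root is black. A blocking triple is a triple $x\lessdot y\lessdot z$ (covering relations) with $x,y$ of the same color and $z$ of a different color. $\mathrm{Po}(P)$ denotes the pomax game on $P$: White (Left, positive) and Black (Right, negative) alternately remove a maximal element of the remaining subposet of their own color; a player who cannot move loses. Pomax games are integer-valued in Conway's sense. For an integer $m$, $-m$ denotes the standard integer game ($m$ copies of $-1=\{\,|\,0\}$ if $m\ge0$, or $|m|$ copies of $1=\{0\,|\,\}$ if $m<0$), and $\mathrm{Po}(P)-m$ is the disjunctive sum. -}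

module Defs where

open import Data.List using (List; []; _∷_)
open import Data.List.Relation.Unary.Any using (Any)
open import Data.Maybe using (Maybe; just; nothing)
open import Data.Product using (_×_; _,_; Σ)
open import Data.Empty using (⊥)
open import Data.Unit using (⊤)
open import Relation.Nullary using (¬_)
open import Relation.Binary.PropositionalEquality using (_≡_; _≢_)
open import Data.Integer as ℤ using (ℤ; +0)

data Color : Set where
  white black : Color

-- Nonempty finite colored tree posets, as rooted (rose) trees.
-- The elements of the poset are the nodes; x ≤ y iff x is an ancestor of
-- (or equal to) y.  The root is the minimum; a child covers its parent.
-- Hence the maximal elements of a (remaining) subposet are its leaves.

data Tree : Set where
  node : Color → List Tree → Tree

rootColor : Tree → Color
rootColor (node c _) = c

children : Tree → List Tree
children (node _ ts) = ts

data HasWhite : Tree → Set where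
  rootWhite : ∀ {ts} → HasWhite (node white ts)
  inChild   : ∀ {c ts} → Any HasWhite ts → HasWhite (node c ts)

data HasBlocking : Tree → Set where
  here  : ∀ {c ts} →
          Any (λ y → rootColor y ≡ c ×
                     Any (λ z → rootColor z ≢ c) (children y)) ts →
          HasBlocking (node c ts)
  there : ∀ {c ts} → Any HasBlocking ts → HasBlocking (node c ts)

-- Removing a maximal element (leaf) of colour c.
-- Result `nothing` means the poset became empty.

mutual
  data Remove (c : Color) : Tree → Maybe Tree → Set where
    leaf   : Remove c (node c []) nothing
    inside : ∀ {d ts ts'} → RemoveIn c ts ts' →
             Remove c (node d ts) (just (node d ts'))

  data RemoveIn (c : Color) : List Tree → List Tree → Set where
    hereDel : ∀ {t ts} → Remove c t nothing → RemoveIn c (t ∷ ts) ts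
    hereUpd : ∀ {t t' ts} → Remove c t (just t') → RemoveIn c (t ∷ ts) (t' ∷ ts)
    there   : ∀ {t ts ts'} → RemoveIn c ts ts' → RemoveIn c (t ∷ ts) (t ∷ ts')

-- Positions of the disjunctive sum Po(P) + k, where the integer
-- component k ∈ ℤ stands for k copies of 1 = {0|} if k ≥ 0 and
-- |k| copies of -1 = {|0} if k < 0.  (So Po(P) - m starts at k = - m.)

Pos : Set
Pos = Maybe Tree × ℤ

data WMove : Pos → Pos → Set where
  poMove  : ∀ {t t' k} → Remove white t t' → WMove (just t , k) (t' , k)
  intMove : ∀ {t k} → +0 ℤ.< k → WMove (t , k) (t , ℤ.pred k)

data BMove : Pos → Pos → Set where
  poMove  : ∀ {t t' k} → Remove black t t' → BMove (just t , k) (t' , k)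
  intMove : ∀ {t k} → k ℤ.< +0 → BMove (t , k) (t , ℤ.suc k)

-- Winning (normal play: a player unable to move loses).
-- `WinsWaiting Mine Theirs Safe p`: the player whose moves are `Mine`,
-- with the opponent (moves `Theirs`) to move at p, has a winning strategy
-- such that every position in which the opponent is to move satisfies Safe.
-- Being inductive, these encode well-founded strategy trees.

module _ {Pos : Set} (Mine Theirs : Pos → Pos → Set) (Safe : Pos → Set) where
  mutual
    data WinsMoving : Pos → Set where
      move : ∀ {p} p' → Mine p p' → WinsWaiting p' → WinsMoving p

    data WinsWaiting : Pos → Set where
      wait : ∀ {p} → Safe p → (∀ p' → Theirs p p' → WinsMoving p') →
             WinsWaiting p

NoCondition : Pos → Set
NoCondition _ = ⊤

-- Conway: G = m  iff  G - m is a second-player win (in both orders).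
HasValue : Tree → ℤ → Set
HasValue P m =
  WinsWaiting WMove BMove NoCondition (just P , ℤ.- m) ×
  WinsWaiting BMove WMove NoCondition (just P , ℤ.- m)

-- The root of P is still present and maximal: the remaining poset of the
-- Po(P) component is the root alone.
RootMaximal : Maybe Tree → Set
RootMaximal (just (node _ [])) = ⊤
RootMaximal (just (node _ (_ ∷ _))) = ⊥
RootMaximal nothing = ⊥

RootSafe : Pos → Set
RootSafe (t , _) = ¬ RootMaximal t

module Submission where

-- Without blocking triples every child of the black root is either white-rooted
-- or heads an all-black subtree, and Black can never remove a white child.  So
-- White may follow a winning strategy S of Po(P) - m (Black first) as long as
-- some child of the root is white: then the root is not maximal on Black's turn.
-- If S would remove the last white child, S's continuation wins an all-black
-- position, which forces the integer component to exceed the number of black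
-- elements left below the root.  White plays an integer move instead, keeps the
-- white child, and answers every later black removal by another integer move.

open import Defs
open import Algebra.Properties.CommutativeSemigroup using (x∙yz≈y∙xz)
open import Data.Empty using (⊥-elim)
open import Data.Integer as ℤ using (ℤ; -_; +_; -[1+_]; +<+; -<+)
open import Data.List using (List; []; _∷_)
open import Data.List.Relation.Unary.All as All using (All; []; _∷_)
open import Data.List.Relation.Unary.All.Properties using (¬Any⇒All¬)
open import Data.List.Relation.Unary.Any using (Any; here; there)
open import Data.Maybe using (Maybe; just; nothing; maybe′)
import Data.Maybe.Relation.Unary.All as Maybe
open import Data.Nat as ℕ using (ℕ; zero; suc; z≤n; s≤s)
open import Data.Nat.Properties using (+-assoc; +-commutativeSemigroup; suc-injective)
open import Data.Product using (_,_; _×_; ∃-syntax)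
open import Data.Sum as Sum using (_⊎_; inj₁; inj₂)
open import Function using (_∘_)
open import Relation.Nullary using (¬_)
open import Relation.Binary.PropositionalEquality using (_≡_; _≢_; refl; sym; trans; cong)

IsWhite : Tree → Set
IsWhite t = rootColor t ≡ white

data AllBlack : Tree → Set where
  node : ∀ {ts} → All AllBlack ts → AllBlack (node black ts)

WhiteOrAllBlack : Tree → Set
WhiteOrAllBlack t = IsWhite t ⊎ AllBlack t

All⊎⇒Any⊎All : ∀ {A : Set} {P Q : A → Set} {xs} →
               All (λ x → P x ⊎ Q x) xs → Any P xs ⊎ All Q xs
All⊎⇒Any⊎All [] = inj₂ []
All⊎⇒Any⊎All (inj₁ p ∷ _) = inj₁ (here p)
All⊎⇒Any⊎All (inj₂ q ∷ pqs) with All⊎⇒Any⊎All pqs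
... | inj₁ any = inj₁ (there any)
... | inj₂ all = inj₂ (q ∷ all)

weight : Color → ℕ
weight white = 0
weight black = 1

mutual
  blackCount : Tree → ℕ
  blackCount (node c ts) = weight c ℕ.+ blackCountForest ts

  blackCountForest : List Tree → ℕ
  blackCountForest [] = 0
  blackCountForest (t ∷ ts) = blackCount t ℕ.+ blackCountForest ts

blackCountᴹ : Maybe Tree → ℕ
blackCountᴹ = maybe′ blackCount 0

mutual
  blackCount-remove : ∀ {c t r} → Remove c t r →
                      weight c ℕ.+ blackCountᴹ r ≡ blackCount t
  blackCount-remove leaf = refl
  blackCount-remove {c} (inside {d} r) =
    trans (x∙yz≈y∙xz +-commutativeSemigroup (weight c) (weight d) _)
          (cong (weight d ℕ.+_) (blackCount-removeIn r))

  blackCount-removeIn : ∀ {c ts ts'} → RemoveIn c ts ts' →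
                        weight c ℕ.+ blackCountForest ts' ≡ blackCountForest ts
  blackCount-removeIn {c} (hereDel rm) =
    trans (sym (+-assoc (weight c) 0 _)) (cong (ℕ._+ _) (blackCount-remove rm))
  blackCount-removeIn {c} (hereUpd rm) =
    trans (sym (+-assoc (weight c) _ _)) (cong (ℕ._+ _) (blackCount-remove rm))
  blackCount-removeIn {c} (there {t} r) =
    trans (x∙yz≈y∙xz +-commutativeSemigroup (weight c) (blackCount t) _)
          (cong (blackCount t ℕ.+_) (blackCount-removeIn r))

rootColor-remove : ∀ {c t t'} → Remove c t (just t') → rootColor t' ≡ rootColor t
rootColor-remove (inside _) = refl

rootColor-remove-nothing : ∀ {c t} → Remove c t nothing → rootColor t ≡ c
rootColor-remove-nothing leaf = refl

All-removeIn : ∀ {P : Tree → Set} {c ts ts'} →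
               (∀ {t t'} → P t → Remove c t (just t') → P t') →
               All P ts → RemoveIn c ts ts' → All P ts'
All-removeIn _ (_ ∷ ps) (hereDel _) = ps
All-removeIn pres (p ∷ ps) (hereUpd rm) = pres p rm ∷ ps
All-removeIn pres (p ∷ ps) (there r) = p ∷ All-removeIn pres ps r

mutual
  AllBlack-remove : ∀ {c t t'} → AllBlack t → Remove c t (just t') → AllBlack t'
  AllBlack-remove (node bs) (inside r) = node (AllBlack-removeIn bs r)

  AllBlack-removeIn : ∀ {c ts ts'} → All AllBlack ts → RemoveIn c ts ts' → All AllBlack ts'
  AllBlack-removeIn (_ ∷ bs) (hereDel _) = bs
  AllBlack-removeIn (b ∷ bs) (hereUpd rm) = AllBlack-remove b rm ∷ bs
  AllBlack-removeIn (b ∷ bs) (there r) = b ∷ AllBlack-removeIn bs r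

WhiteOrAllBlack-remove : ∀ {c t t'} → WhiteOrAllBlack t → Remove c t (just t') →
                         WhiteOrAllBlack t'
WhiteOrAllBlack-remove (inj₁ w) rm = inj₁ (trans (rootColor-remove rm) w)
WhiteOrAllBlack-remove (inj₂ b) rm = inj₂ (AllBlack-remove b rm)

whiteChild-removeIn-black : ∀ {ts ts'} → Any IsWhite ts → RemoveIn black ts ts' →
                            Any IsWhite ts'
whiteChild-removeIn-black (here w) (hereDel rm) with trans (sym w) (rootColor-remove-nothing rm)
... | ()
whiteChild-removeIn-black (here w) (hereUpd rm) = here (trans (rootColor-remove rm) w)
whiteChild-removeIn-black (here w) (there _) = here w
whiteChild-removeIn-black (there w) (hereDel _) = w
whiteChild-removeIn-black (there w) (hereUpd _) = there w
whiteChild-removeIn-black (there w) (there r) = there (whiteChild-removeIn-black w r)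

mutual
  AllBlack⇒¬Remove-white : ∀ {t r} → AllBlack t → ¬ Remove white t r
  AllBlack⇒¬Remove-white (node bs) (inside r) = AllBlack⇒¬RemoveIn-white bs r

  AllBlack⇒¬RemoveIn-white : ∀ {ts ts'} → All AllBlack ts → ¬ RemoveIn white ts ts'
  AllBlack⇒¬RemoveIn-white (b ∷ _) (hereDel rm) = AllBlack⇒¬Remove-white b rm
  AllBlack⇒¬RemoveIn-white (b ∷ _) (hereUpd rm) = AllBlack⇒¬Remove-white b rm
  AllBlack⇒¬RemoveIn-white (_ ∷ bs) (there r) = AllBlack⇒¬RemoveIn-white bs r

AllBlack⇒Remove-black : ∀ {t} → AllBlack t →
                        ∃[ r ] Remove black t r × Maybe.All AllBlack r
AllBlack⇒Remove-black (node []) = nothing , leaf , Maybe.nothing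
AllBlack⇒Remove-black (node {t ∷ ts} (b ∷ bs)) with AllBlack⇒Remove-black b
... | nothing , rm , _ = just (node black ts) , inside (hereDel rm) , Maybe.just (node bs)
... | just t' , rm , Maybe.just b' =
  just (node black (t' ∷ ts)) , inside (hereUpd rm) , Maybe.just (node (b' ∷ bs))

mutual
  AllBlack⇒¬HasWhite : ∀ {t} → AllBlack t → ¬ HasWhite t
  AllBlack⇒¬HasWhite (node bs) (inChild w) = AllBlack⇒¬AnyHasWhite bs w

  AllBlack⇒¬AnyHasWhite : ∀ {ts} → All AllBlack ts → ¬ Any HasWhite ts
  AllBlack⇒¬AnyHasWhite (b ∷ _) (here w) = AllBlack⇒¬HasWhite b w
  AllBlack⇒¬AnyHasWhite (_ ∷ bs) (there w) = AllBlack⇒¬AnyHasWhite bs w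

HasBlocking-cons : ∀ {c u us} → HasBlocking (node c us) → HasBlocking (node c (u ∷ us))
HasBlocking-cons (here b) = here (there b)
HasBlocking-cons (there b) = there (there b)

¬≢black⇒≡black : ∀ {c} → ¬ c ≢ black → c ≡ black
¬≢black⇒≡black {white} ¬c≢black = ⊥-elim (¬c≢black λ ())
¬≢black⇒≡black {black} _ = refl

mutual
  noBlocking⇒AllBlack-blackChild : ∀ {vs us} →
    ¬ HasBlocking (node black (node black vs ∷ us)) → AllBlack (node black vs)
  noBlocking⇒AllBlack-blackChild {vs} nb =
    node (noBlocking⇒AllBlack-blackChildren (λ b → nb (there (here b)))
           (All.map ¬≢black⇒≡black (¬Any⇒All¬ vs λ z → nb (here (here (refl , z))))))

  noBlocking⇒AllBlack-blackChildren : ∀ {us} → ¬ HasBlocking (node black us) →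
    All (λ u → rootColor u ≡ black) us → All AllBlack us
  noBlocking⇒AllBlack-blackChildren _ [] = []
  noBlocking⇒AllBlack-blackChildren {node black _ ∷ _} nb (refl ∷ bs) =
    noBlocking⇒AllBlack-blackChild nb
    ∷ noBlocking⇒AllBlack-blackChildren (nb ∘ HasBlocking-cons) bs

noBlocking⇒WhiteOrAllBlack : ∀ {us} → ¬ HasBlocking (node black us) →
                             All WhiteOrAllBlack us
noBlocking⇒WhiteOrAllBlack {[]} _ = []
noBlocking⇒WhiteOrAllBlack {node white _ ∷ _} nb =
  inj₁ refl ∷ noBlocking⇒WhiteOrAllBlack (nb ∘ HasBlocking-cons)
noBlocking⇒WhiteOrAllBlack {node black _ ∷ _} nb =
  inj₂ (noBlocking⇒AllBlack-blackChild nb)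
  ∷ noBlocking⇒WhiteOrAllBlack (nb ∘ HasBlocking-cons)

whiteStuck-empty : ∀ {Safe} n → ¬ WinsMoving WMove BMove Safe (nothing , ℤ.suc -[1+ n ])
whiteStuck-empty zero (move _ (intMove (+<+ ())) _)
whiteStuck-empty (suc n) (move _ (intMove ()) _)

-- Black keeps removing black leaves, so White can only spend integer moves.
mutual
  allBlack-waiting-bound : ∀ {Safe} r k → Maybe.All AllBlack r →
    WinsWaiting WMove BMove Safe (r , k) → ∃[ e ] k ≡ + (blackCountᴹ r ℕ.+ e)
  allBlack-waiting-bound nothing (+ n) _ _ = n , refl
  allBlack-waiting-bound nothing -[1+ n ] _ (wait _ reply) =
    ⊥-elim (whiteStuck-empty n (reply _ (intMove -<+)))
  allBlack-waiting-bound (just _) k (Maybe.just b) (wait _ reply) with AllBlack⇒Remove-black b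
  ... | r , rm , b' with allBlack-moving-bound r k b' (reply _ (poMove rm))
  ... | e , eq = e , trans eq (cong (λ n → + (n ℕ.+ e)) (blackCount-remove rm))

  allBlack-moving-bound : ∀ {Safe} r k → Maybe.All AllBlack r →
    WinsMoving WMove BMove Safe (r , k) → ∃[ e ] k ≡ + (suc (blackCountᴹ r) ℕ.+ e)
  allBlack-moving-bound (just _) k (Maybe.just b) (move _ (poMove rm) _) =
    ⊥-elim (AllBlack⇒¬Remove-white b rm)
  allBlack-moving-bound r (+ suc n) b (move _ (intMove (+<+ (s≤s z≤n))) S)
    with allBlack-waiting-bound r (+ n) b S
  ... | e , refl = e , refl

whiteChild⇒¬RootMaximal : ∀ {ts} → Any IsWhite ts → ¬ RootMaximal (just (node black ts))
whiteChild⇒¬RootMaximal (here _) = λ ()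
whiteChild⇒¬RootMaximal (there _) = λ ()

mutual
  integerDefence : ∀ n {ts} e → blackCountForest ts ≡ n → Any IsWhite ts →
    WinsWaiting WMove BMove RootSafe (just (node black ts) , + (n ℕ.+ e))
  integerDefence n e count w =
    wait (whiteChild⇒¬RootMaximal w) (λ _ mv → integerDefence-reply n e count w mv)

  integerDefence-reply : ∀ n {ts} e {p} → blackCountForest ts ≡ n → Any IsWhite ts →
    BMove (just (node black ts) , + (n ℕ.+ e)) p → WinsMoving WMove BMove RootSafe p
  integerDefence-reply _ _ _ () (poMove leaf)
  integerDefence-reply zero _ count _ (poMove (inside r)) with trans (blackCount-removeIn r) count
  ... | ()
  integerDefence-reply (suc n) e count w (poMove (inside r)) =
    move _ (intMove (+<+ (s≤s z≤n)))
      (integerDefence n e (suc-injective (trans (blackCount-removeIn r) count))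
                      (whiteChild-removeIn-black w r))
  integerDefence-reply _ _ _ _ (intMove (+<+ ()))

hasWhite⇒whiteChild : ∀ {ts} → Any HasWhite ts → All WhiteOrAllBlack ts → Any IsWhite ts
hasWhite⇒whiteChild hasWhite ws with All⊎⇒Any⊎All ws
... | inj₁ w = w
... | inj₂ bs = ⊥-elim (AllBlack⇒¬AnyHasWhite bs hasWhite)

data Guarded : Pos → Set where
  guarded : ∀ {ts k} → Any IsWhite ts → All WhiteOrAllBlack ts →
            Guarded (just (node black ts) , k)

data Exhausted (ts : List Tree) (k : ℤ) : Pos → Set where
  exhausted : ∀ {ts'} → All AllBlack ts' → blackCountForest ts' ≡ blackCountForest ts →
              Exhausted ts k (just (node black ts') , k)

Guarded-blackMove : ∀ {p p'} → Guarded p → BMove p p' → Guarded p'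
Guarded-blackMove (guarded () _) (poMove leaf)
Guarded-blackMove (guarded w ws) (poMove (inside r)) =
  guarded (whiteChild-removeIn-black w r) (All-removeIn WhiteOrAllBlack-remove ws r)
Guarded-blackMove (guarded w ws) (intMove _) = guarded w ws

Guarded-whiteMove : ∀ {ts k p} → Any IsWhite ts → All WhiteOrAllBlack ts →
                    WMove (just (node black ts) , k) p → Guarded p ⊎ Exhausted ts k p
Guarded-whiteMove w ws (intMove _) = inj₁ (guarded w ws)
Guarded-whiteMove w ws (poMove (inside {ts' = ts'} r)) =
  Sum.map (λ w' → guarded w' ws') (λ bs → exhausted bs (blackCount-removeIn r))
          (All⊎⇒Any⊎All ws')
  where
  ws' : All WhiteOrAllBlack ts'
  ws' = All-removeIn WhiteOrAllBlack-remove ws r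

mutual
  protectRoot : ∀ {p} → Guarded p → WinsWaiting WMove BMove NoCondition p →
                WinsWaiting WMove BMove RootSafe p
  protectRoot g@(guarded w _) (wait _ reply) =
    wait (whiteChild⇒¬RootMaximal w)
         (λ p mv → protectRoot-move (Guarded-blackMove g mv) (reply p mv))

  protectRoot-move : ∀ {p} → Guarded p → WinsMoving WMove BMove NoCondition p →
                     WinsMoving WMove BMove RootSafe p
  protectRoot-move (guarded {k = k} w ws) (move p mv S) with Guarded-whiteMove w ws mv
  ... | inj₁ g = move p mv (protectRoot g S)
  ... | inj₂ (exhausted {ts'} bs count)
    -- S would now win an all-black position, so k exceeds the black count; deviate.
    with allBlack-waiting-bound (just (node black ts')) k (Maybe.just (node bs)) S
  ...   | e , refl =
    move _ (intMove (+<+ (s≤s z≤n))) (integerDefence (blackCountForest ts') e (sym count) w)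

mainTheorem12 : (ts : List Tree) (m : ℤ) →
    HasWhite (node black ts) → ¬ HasBlocking (node black ts) →
    HasValue (node black ts) m →
    WinsWaiting WMove BMove RootSafe (just (node black ts) , - m)
mainTheorem12 ts m (inChild hasWhite) noBlocking (S , _) =
  protectRoot (guarded (hasWhite⇒whiteChild hasWhite ws) ws) S
  where
  ws : All WhiteOrAllBlack ts
  ws = noBlocking⇒WhiteOrAllBlack noBlocking
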